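{- $\|\mathsf{BSML}\|\subsetneq\mathbb{U}=\{\mathcal{P}\mid\mathcal{P}\text{ is invariant under bounded bisimulation and union closed}\}$.
   Context: Fix a countably infinite set $\mathsf{Prop}$ of propositional variables. Formulas of $\mathsf{BSML}$ are generated by $\phi ::= p \mid \neg\phi \mid (\phi\wedge\phi) \mid (\phi\vee\phi) \mid \Diamond\phi \mid \mathrm{NE}$ ($p\in\mathsf{Prop}$). A Kripke model over $\mathsf{X}\subseteq\mathsf{Prop}$ is $M=(W,R,V)$ with $W\neq\emptyset$, $R\subseteq W\times W$, $V:\mathsf{X}\to\wp(W)$; a state is any $s\subseteq W$, and $R[w]=\{v\mid wRv\}$. Support $M,s\vDash\phi$ and anti-support $M,s\mathrel{=\!\!\mid}\phi$ are defined by: $s\vDash p$ iff $w\in V(p)$ for all $w\in s$; $s\mathrel{=\!\!\mid} p$ iff $w\notin V(p)$ for all $w\in s$; $s\vDash\mathrm{NE}$ iff $s\neq\emptyset$; $s\mathrel{=\!\!\mid}\mathrm{NE}$ iff $s=\emptyset$; $s\vDash\neg\phi$ iff $s\mathrel{=\!\!\mid}\phi$; $s\mathrel{=\!\!\mid}\neg\phi$ iff $s\vDash\phi$; $s\vDash\phi\wedge\psi$ iff $s\vDash\phi$ and $s\vDash\psi$; $s\mathrel{=\!\!\mid}\phi\wedge\psi$ iff $s=t\cup u$ with $t\mathrel{=\!\!\mid}\phi$, $u\mathrel{=\!\!\mid}\psi$; $s\vDash\phi\vee\psi$ iff $s=t\cup u$ with $t\vDash\phi$, $u\vDash\psi$;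 $s\mathrel{=\!\!\mid}\phi\vee\psi$ iff $s\mathrel{=\!\!\mid}\phi$ and $s\mathrel{=\!\!\mid}\psi$; $s\vDash\Diamond\phi$ iff for every $w\in s$ there is a nonempty $t\subseteq R[w]$ with $t\vDash\phi$; $s\mathrel{=\!\!\mid}\Diamond\phi$ iff $R[w]\mathrel{=\!\!\mid}\phi$ for all $w\in s$. Bisimulation (over fixed $\mathsf{X}$): $M,w\rightleftharpoons_0 M',w'$ iff $w,w'$ satisfy the same variables of $\mathsf{X}$; $w\rightleftharpoons_{k+1}w'$ iff $w\rightleftharpoons_0 w'$, each $v\in R[w]$ has some $v'\in R'[w']$ with $v\rightleftharpoons_k v'$, and each $v'\in R'[w']$ has some $v\in R[w]$ with $v\rightleftharpoons_k v'$. For states, $M,s\rightleftharpoons_k M',s'$ iff each $w\in s$ has some $w'\in s'$ with $w\rightleftharpoons_k w'$ and vice versa. A state property is a set of pointed state models $(M,s)$ over $\mathsf{X}$; $\|\phi\|=\{(M,s)\mid M,s\vDash\phi\}$, $\|\mathsf{BSML}\|=\{\|\phi\|\mid\phi\in\mathsf{BSML}\}$. $\mathcal{P}$ is invariant under bounded bisimulation if for some $k$, $(M,s)\in\mathcal{P}$ and $M,s\rightleftharpoons_k M',s'$ imply $(M',s')\in\mathcal{P}$; $\mathcal{P}$ is union closed if whenever $(M,s)\in\mathcal{P}$ for all $s\in S\neq\emptyset$, then $(M,\bigcup S)\in\mathcal{P}$. -}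

module Defs where

open import Level using (Level; 0ℓ) renaming (suc to lsuc)
open import Data.Nat using (ℕ; zero; suc; _⊔_)
open import Data.Product using (Σ; ∃; _×_; _,_)
open import Data.Sum using (_⊎_)
open import Data.Empty using (⊥)
open import Relation.Nullary using (¬_)
open import Function.Bundles using (_⇔_)

PropSet : Set₁
PropSet = ℕ → Set

data Form (X : PropSet) : Set where
  var  : (p : ℕ) → X p → Form X
  ¬'_  : Form X → Form X
  _∧'_ : Form X → Form X → Form X
  _∨'_ : Form X → Form X → Form X
  ◇_   : Form X → Form X
  NE   : Form X

record Model (X : PropSet) : Set₁ where
  field
    W : Set
    R : W → W → Set
    V : (p : ℕ) → X p → W → Set
    inhabited : W
open Model public

State : ∀ {X} → Model X → Set₁
State M = W M → Set

IsUnion : ∀ {X} {M : Model X} → State M → State M → State M → Set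
IsUnion {M = M} s t u = (w : W M) → s w ⇔ (t w ⊎ u w)

_⊆_ : ∀ {X} {M : Model X} → State M → State M → Set
_⊆_ {M = M} t s = (w : W M) → t w → s w

Empty : ∀ {X} {M : Model X} → State M → Set
Empty {M = M} s = (w : W M) → ¬ s w

NonEmpty : ∀ {X} {M : Model X} → State M → Set
NonEmpty {M = M} s = Σ (W M) s

Succ : ∀ {X} (M : Model X) → W M → State M
Succ M w v = R M w v

mutual
  _,_⊨_ : ∀ {X} (M : Model X) → State M → Form X → Set₁
  M , s ⊨ var p x = Level.Lift (lsuc 0ℓ) ((w : W M) → s w → V M p x w)
  M , s ⊨ (¬' φ) = M , s ⫤ φ
  M , s ⊨ (φ ∧' ψ) = (M , s ⊨ φ) × (M , s ⊨ ψ)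
  M , s ⊨ (φ ∨' ψ) = Σ (State M) λ t → Σ (State M) λ u →
                       Level.Lift (lsuc 0ℓ) (IsUnion {M = M} s t u) × (M , t ⊨ φ) × (M , u ⊨ ψ)
  M , s ⊨ (◇ φ) = (w : W M) → s w → Σ (State M) λ t →
                       Level.Lift (lsuc 0ℓ) (_⊆_ {M = M} t (Succ M w) × NonEmpty {M = M} t) × (M , t ⊨ φ)
  M , s ⊨ NE = Level.Lift (lsuc 0ℓ) (NonEmpty {M = M} s)

  _,_⫤_ : ∀ {X} (M : Model X) → State M → Form X → Set₁
  M , s ⫤ var p x = Level.Lift (lsuc 0ℓ) ((w : W M) → s w → ¬ V M p x w)
  M , s ⫤ (¬' φ) = M , s ⊨ φ
  M , s ⫤ (φ ∧' ψ) = Σ (State M) λ t → Σ (State M) λ u →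
                       Level.Lift (lsuc 0ℓ) (IsUnion {M = M} s t u) × (M , t ⫤ φ) × (M , u ⫤ ψ)
  M , s ⫤ (φ ∨' ψ) = (M , s ⫤ φ) × (M , s ⫤ ψ)
  M , s ⫤ (◇ φ) = (w : W M) → s w → M , Succ M w ⫤ φ
  M , s ⫤ NE = Level.Lift (lsuc 0ℓ) (Empty {M = M} s)

Bisim : ∀ {X} → ℕ → (M : Model X) → W M → (M' : Model X) → W M' → Set
Bisim {X} zero M w M' w' = (p : ℕ) (x : X p) → V M p x w ⇔ V M' p x w'
Bisim {X} (suc k) M w M' w' =
  Bisim zero M w M' w' ×
  ((v : W M) → R M w v → Σ (W M') λ v' → R M' w' v' × Bisim k M v M' v') ×
  ((v' : W M') → R M' w' v' → Σ (W M) λ v → R M w v × Bisim k M v M' v')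

BisimState : ∀ {X} → ℕ → (M : Model X) → State M → (M' : Model X) → State M' → Set
BisimState k M s M' s' =
  ((w : W M) → s w → Σ (W M') λ w' → s' w' × Bisim k M w M' w') ×
  ((w' : W M') → s' w' → Σ (W M) λ w → s w × Bisim k M w M' w')

StateProperty : PropSet → Set₂
StateProperty X = (M : Model X) → State M → Set₁

⟦_⟧ : ∀ {X} → Form X → StateProperty X
⟦ φ ⟧ M s = M , s ⊨ φ

InBSML : (X : PropSet) → StateProperty X → Set₁
InBSML X P = Σ (Form X) λ φ → (M : Model X) (s : State M) → P M s ⇔ ⟦ φ ⟧ M s

InvariantBoundedBisim : (X : PropSet) → StateProperty X → Set₁
InvariantBoundedBisim X P = Σ ℕ λ k →
  (M : Model X) (s : State M) (M' : Model X) (s' : State M') →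
  P M s → BisimState k M s M' s' → P M' s'

-- Union of a nonempty set of states, given as a family indexed by an inhabited I
⋃ : ∀ {X} {M : Model X} {I : Set} → (I → State M) → State M
⋃ {M = M} {I} S w = Σ I λ i → S i w

UnionClosed : (X : PropSet) → StateProperty X → Set₁
UnionClosed X P = (M : Model X) (I : Set) (S : I → State M) →
  I → ((i : I) → P M (S i)) → P M (⋃ {M = M} S)

InU : (X : PropSet) → StateProperty X → Set₁
InU X P = InvariantBoundedBisim X P × UnionClosed X P

{-# OPTIONS --safe #-}
-- Every BSML formula is union closed and invariant under k-bisimulation for k its modal
-- depth, for support and anti-support simultaneously. The inclusion is strict because BSML
-- properties are moreover convex: the property "s is empty or some world of s has a
-- successor" is union closed and 1-bisimulation invariant, but on the two-world frame
-- w → v it holds of ∅ and of {w, v} and fails on {v}.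
module Submission where

open import Defs
open import Data.Product using (Σ; _×_; _,_; proj₁; proj₂)
open import Relation.Nullary using (¬_)
open import Level using (Lift; lift; lower; 0ℓ) renaming (suc to lsuc)
open import Data.Nat using (ℕ; zero; suc; _≤_; s≤s; _⊔_)
open import Data.Nat.Properties using (≤-refl; m⊔n≤o⇒m≤o; m⊔n≤o⇒n≤o)
open import Data.Sum using (_⊎_; inj₁; inj₂)
open import Data.Bool using (Bool; true; false; if_then_else_)
open import Data.Unit using (⊤; tt)
open import Data.Empty using (⊥)
open import Relation.Unary using (_∪_; _∩_)
open import Relation.Binary.PropositionalEquality using (_≡_; refl)
open import Function.Bundles using (mk⇔; Equivalence)
open Equivalence

modalDepth : ∀ {X} → Form X → ℕ
modalDepth (var p x) = zero
modalDepth (¬' φ) = modalDepth φ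
modalDepth (φ ∧' ψ) = modalDepth φ ⊔ modalDepth ψ
modalDepth (φ ∨' ψ) = modalDepth φ ⊔ modalDepth ψ
modalDepth (◇ φ) = suc (modalDepth φ)
modalDepth NE = zero

⟦_⟧⁻ : ∀ {X} → Form X → StateProperty X
⟦ φ ⟧⁻ M s = M , s ⫤ φ

module _ {X : PropSet} (M : Model X) where

  UnionClosedIn : (State M → Set₁) → Set₁
  UnionClosedIn F = (I : Set) (S : I → State M) → I → ((i : I) → F (S i)) → F (⋃ {M = M} S)

  ConvexIn : (State M → Set₁) → Set₁
  ConvexIn F = (s t u : State M) →
    _⊆_ {M = M} s t → _⊆_ {M = M} t u → F s → F u → F t

  -- The common shape of the support of φ ∨ ψ and the anti-support of φ ∧ ψ.
  Split : (State M → Set₁) → (State M → Set₁) → State M → Set₁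
  Split F G s = Σ (State M) λ t → Σ (State M) λ u →
    Lift (lsuc 0ℓ) (IsUnion {M = M} s t u) × F t × G u

  binaryUnion : State M → State M → State M
  binaryUnion s u = ⋃ {M = M} (λ b → if b then s else u)

  unionClosed⇒binaryUnion : {F : State M → Set₁} → UnionClosedIn F →
    (s u : State M) → F s → F u → F (binaryUnion s u)
  unionClosed⇒binaryUnion uc s u Fs Fu = uc Bool _ true λ { true → Fs ; false → Fu }

  ⋃-IsUnion : {I : Set} (S T U : I → State M) →
    ((i : I) → IsUnion {M = M} (S i) (T i) (U i)) →
    IsUnion {M = M} (⋃ {M = M} S) (⋃ {M = M} T) (⋃ {M = M} U)
  ⋃-IsUnion S T U e w = mk⇔ split join
    where
    split : ⋃ {M = M} S w → (⋃ {M = M} T w ⊎ ⋃ {M = M} U w)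
    split (i , sw) with to (e i w) sw
    ... | inj₁ tw = inj₁ (i , tw)
    ... | inj₂ uw = inj₂ (i , uw)
    join : (⋃ {M = M} T w ⊎ ⋃ {M = M} U w) → ⋃ {M = M} S w
    join (inj₁ (i , tw)) = i , from (e i w) (inj₁ tw)
    join (inj₂ (i , uw)) = i , from (e i w) (inj₂ uw)

  Split-unionClosed : {F G : State M → Set₁} →
    UnionClosedIn F → UnionClosedIn G → UnionClosedIn (Split F G)
  Split-unionClosed ucF ucG I S i₀ h =
    ⋃ {M = M} T , ⋃ {M = M} U , lift (⋃-IsUnion S T U (λ i → lower (proj₁ (proj₂ (proj₂ (h i)))))) ,
    ucF I T i₀ (λ i → proj₁ (proj₂ (proj₂ (proj₂ (h i))))) ,
    ucG I U i₀ (λ i → proj₂ (proj₂ (proj₂ (proj₂ (h i)))))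
    where
    T U : I → State M
    T i = proj₁ (h i)
    U i = proj₁ (proj₂ (h i))

  -- With s = s₁ ∪ s₂ and u = u₁ ∪ u₂, split t as (s₁ ∪ (t ∩ u₁)) ∪ (s₂ ∪ (t ∩ u₂)); each part
  -- lies between sᵢ and sᵢ ∪ uᵢ, which is a witness by union closure.
  Split-convex : {F G : State M → Set₁} →
    UnionClosedIn F → ConvexIn F → UnionClosedIn G → ConvexIn G → ConvexIn (Split F G)
  Split-convex {F} {G} ucF cvF ucG cvG s t u s⊆t t⊆u
               (s₁ , s₂ , lift s≡ , Fs₁ , Gs₂) (u₁ , u₂ , lift u≡ , Fu₁ , Gu₂) =
    t₁ , t₂ , lift (λ w → mk⇔ (split w) (join w)) ,
    cvF s₁ t₁ (binaryUnion s₁ u₁) (λ _ → inj₁) (between s₁ u₁)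
        Fs₁ (unionClosed⇒binaryUnion ucF s₁ u₁ Fs₁ Fu₁) ,
    cvG s₂ t₂ (binaryUnion s₂ u₂) (λ _ → inj₁) (between s₂ u₂)
        Gs₂ (unionClosed⇒binaryUnion ucG s₂ u₂ Gs₂ Gu₂)
    where
    t₁ t₂ : State M
    t₁ = s₁ ∪ (t ∩ u₁)
    t₂ = s₂ ∪ (t ∩ u₂)
    between : (a b : State M) → _⊆_ {M = M} (a ∪ (t ∩ b)) (binaryUnion a b)
    between a b w (inj₁ aw) = true , aw
    between a b w (inj₂ (_ , bw)) = false , bw
    split : (w : W M) → t w → (t₁ ∪ t₂) w
    split w tw with to (u≡ w) (t⊆u w tw)
    ... | inj₁ u₁w = inj₁ (inj₂ (tw , u₁w))
    ... | inj₂ u₂w = inj₂ (inj₂ (tw , u₂w))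
    join : (w : W M) → (t₁ ∪ t₂) w → t w
    join w (inj₁ (inj₁ s₁w)) = s⊆t w (from (s≡ w) (inj₁ s₁w))
    join w (inj₁ (inj₂ (tw , _))) = tw
    join w (inj₂ (inj₁ s₂w)) = s⊆t w (from (s≡ w) (inj₂ s₂w))
    join w (inj₂ (inj₂ (tw , _))) = tw

mutual
  ⊨-unionClosed : ∀ {X} (φ : Form X) (M : Model X) → UnionClosedIn M (⟦ φ ⟧ M)
  ⊨-unionClosed (var p x) M I S i₀ h = lift λ { w (i , sw) → lower (h i) w sw }
  ⊨-unionClosed (¬' φ) = ⫤-unionClosed φ
  ⊨-unionClosed (φ ∧' ψ) M I S i₀ h =
    ⊨-unionClosed φ M I S i₀ (λ i → proj₁ (h i)) , ⊨-unionClosed ψ M I S i₀ (λ i → proj₂ (h i))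
  ⊨-unionClosed (φ ∨' ψ) M = Split-unionClosed M (⊨-unionClosed φ M) (⊨-unionClosed ψ M)
  ⊨-unionClosed (◇ φ) M I S i₀ h w (i , sw) = h i w sw
  ⊨-unionClosed NE M I S i₀ h = let (w , sw) = lower (h i₀) in lift (w , i₀ , sw)

  ⫤-unionClosed : ∀ {X} (φ : Form X) (M : Model X) → UnionClosedIn M (⟦ φ ⟧⁻ M)
  ⫤-unionClosed (var p x) M I S i₀ h = lift λ { w (i , sw) → lower (h i) w sw }
  ⫤-unionClosed (¬' φ) = ⊨-unionClosed φ
  ⫤-unionClosed (φ ∧' ψ) M = Split-unionClosed M (⫤-unionClosed φ M) (⫤-unionClosed ψ M)
  ⫤-unionClosed (φ ∨' ψ) M I S i₀ h =
    ⫤-unionClosed φ M I S i₀ (λ i → proj₁ (h i)) , ⫤-unionClosed ψ M I S i₀ (λ i → proj₂ (h i))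
  ⫤-unionClosed (◇ φ) M I S i₀ h w (i , sw) = h i w sw
  ⫤-unionClosed NE M I S i₀ h = lift λ { w (i , sw) → lower (h i) w sw }

mutual
  ⊨-convex : ∀ {X} (φ : Form X) (M : Model X) → ConvexIn M (⟦ φ ⟧ M)
  ⊨-convex (var p x) M s t u s⊆t t⊆u hs hu = lift λ w tw → lower hu w (t⊆u w tw)
  ⊨-convex (¬' φ) = ⫤-convex φ
  ⊨-convex (φ ∧' ψ) M s t u s⊆t t⊆u (φs , ψs) (φu , ψu) =
    ⊨-convex φ M s t u s⊆t t⊆u φs φu , ⊨-convex ψ M s t u s⊆t t⊆u ψs ψu
  ⊨-convex (φ ∨' ψ) M =
    Split-convex M (⊨-unionClosed φ M) (⊨-convex φ M) (⊨-unionClosed ψ M) (⊨-convex ψ M)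
  ⊨-convex (◇ φ) M s t u s⊆t t⊆u hs hu w tw = hu w (t⊆u w tw)
  ⊨-convex NE M s t u s⊆t t⊆u (lift (w , sw)) hu = lift (w , s⊆t w sw)

  ⫤-convex : ∀ {X} (φ : Form X) (M : Model X) → ConvexIn M (⟦ φ ⟧⁻ M)
  ⫤-convex (var p x) M s t u s⊆t t⊆u hs hu = lift λ w tw → lower hu w (t⊆u w tw)
  ⫤-convex (¬' φ) = ⊨-convex φ
  ⫤-convex (φ ∧' ψ) M =
    Split-convex M (⫤-unionClosed φ M) (⫤-convex φ M) (⫤-unionClosed ψ M) (⫤-convex ψ M)
  ⫤-convex (φ ∨' ψ) M s t u s⊆t t⊆u (φs , ψs) (φu , ψu) =
    ⫤-convex φ M s t u s⊆t t⊆u φs φu , ⫤-convex ψ M s t u s⊆t t⊆u ψs ψu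
  ⫤-convex (◇ φ) M s t u s⊆t t⊆u hs hu w tw = hu w (t⊆u w tw)
  ⫤-convex NE M s t u s⊆t t⊆u hs (lift hu) = lift λ w tw → hu w (t⊆u w tw)

Bisim⇒Bisim₀ : ∀ {X} k (M : Model X) w (M' : Model X) w' →
  Bisim k M w M' w' → Bisim zero M w M' w'
Bisim⇒Bisim₀ zero M w M' w' b = b
Bisim⇒Bisim₀ (suc k) M w M' w' b = proj₁ b

module _ {X : PropSet} (k : ℕ) (M M' : Model X) where

  Preserved : (State M → Set₁) → (State M' → Set₁) → Set₁
  Preserved F F' = (s : State M) (s' : State M') → BisimState k M s M' s' → F s → F' s'

  BisimImage : State M → State M'
  BisimImage t v' = Σ (W M) λ v → t v × Bisim k M v M' v'

  bisimState-∩-image : (t : State M) (s' : State M') →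
    ((w : W M) → t w → Σ (W M') λ w' → s' w' × Bisim k M w M' w') →
    BisimState k M t M' (s' ∩ BisimImage t)
  bisimState-∩-image t s' forth =
    (λ w tw → let (w' , s'w' , b) = forth w tw in w' , (s'w' , w , tw , b) , b) ,
    (λ { w' (_ , w , tw , b) → w , tw , b })

  bisimState-nonEmpty : (s : State M) (s' : State M') →
    BisimState k M s M' s' → NonEmpty {M = M} s → NonEmpty {M = M'} s'
  bisimState-nonEmpty s s' (forth , _) (w , sw) = let (w' , s'w' , _) = forth w sw in w' , s'w'

  bisimState-split : (s t u : State M) (s' : State M') →
    BisimState k M s M' s' → IsUnion {M = M} s t u →
    Σ (State M') λ t' → Σ (State M') λ u' → IsUnion {M = M'} s' t' u' ×
      BisimState k M t M' t' × BisimState k M u M' u'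
  bisimState-split s t u s' (forth , back) s≡ =
    s' ∩ BisimImage t , s' ∩ BisimImage u , (λ w' → mk⇔ (split w') (join w')) ,
    bisimState-∩-image t s' (λ w tw → forth w (from (s≡ w) (inj₁ tw))) ,
    bisimState-∩-image u s' (λ w uw → forth w (from (s≡ w) (inj₂ uw)))
    where
    split : (w' : W M') → s' w' → ((s' ∩ BisimImage t) ∪ (s' ∩ BisimImage u)) w'
    split w' s'w' with back w' s'w'
    ... | (w , sw , b) with to (s≡ w) sw
    ... | inj₁ tw = inj₁ (s'w' , w , tw , b)
    ... | inj₂ uw = inj₂ (s'w' , w , uw , b)
    join : (w' : W M') → ((s' ∩ BisimImage t) ∪ (s' ∩ BisimImage u)) w' → s' w'
    join w' (inj₁ (s'w' , _)) = s'w'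
    join w' (inj₂ (s'w' , _)) = s'w'

  Split-preserved : {F G : State M → Set₁} {F' G' : State M' → Set₁} →
    Preserved F F' → Preserved G G' → Preserved (Split M F G) (Split M' F' G')
  Split-preserved pF pG s s' B (t , u , lift s≡ , Ft , Gu) =
    let (t' , u' , s'≡ , Bt , Bu) = bisimState-split s t u s' B s≡
    in t' , u' , lift s'≡ , pF t t' Bt Ft , pG u u' Bu Gu

mutual
  ⊨-bisim : ∀ {X} (φ : Form X) k → modalDepth φ ≤ k → (M M' : Model X) →
    Preserved k M M' (⟦ φ ⟧ M) (⟦ φ ⟧ M')
  ⊨-bisim (var p x) k _ M M' s s' (_ , back) h = lift λ w' s'w' →
    let (w , sw , b) = back w' s'w' in to (Bisim⇒Bisim₀ k M w M' w' b p x) (lower h w sw)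
  ⊨-bisim (¬' φ) = ⫤-bisim φ
  ⊨-bisim (φ ∧' ψ) k d≤k M M' s s' B (φs , ψs) =
    ⊨-bisim φ k (m⊔n≤o⇒m≤o (modalDepth φ) _ d≤k) M M' s s' B φs ,
    ⊨-bisim ψ k (m⊔n≤o⇒n≤o (modalDepth φ) _ d≤k) M M' s s' B ψs
  ⊨-bisim (φ ∨' ψ) k d≤k M M' = Split-preserved k M M'
    (⊨-bisim φ k (m⊔n≤o⇒m≤o (modalDepth φ) _ d≤k) M M')
    (⊨-bisim ψ k (m⊔n≤o⇒n≤o (modalDepth φ) _ d≤k) M M')
  ⊨-bisim (◇ φ) (suc k) (s≤s d≤k) M M' s s' (_ , back) h w' s'w' =
    let (w , sw , (_ , forth , _)) = back w' s'w'
        (t , lift (t⊆Rw , t≠∅) , φt) = h w sw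
        Bt = bisimState-∩-image k M M' t (Succ M' w') (λ v tv → forth v (t⊆Rw v tv))
    in Succ M' w' ∩ BisimImage k M M' t ,
       lift ((λ _ → proj₁) , bisimState-nonEmpty k M M' _ _ Bt t≠∅) ,
       ⊨-bisim φ k d≤k M M' _ _ Bt φt
  ⊨-bisim NE k _ M M' s s' B (lift s≠∅) = lift (bisimState-nonEmpty k M M' s s' B s≠∅)

  ⫤-bisim : ∀ {X} (φ : Form X) k → modalDepth φ ≤ k → (M M' : Model X) →
    Preserved k M M' (⟦ φ ⟧⁻ M) (⟦ φ ⟧⁻ M')
  ⫤-bisim (var p x) k _ M M' s s' (_ , back) h = lift λ w' s'w' v →
    let (w , sw , b) = back w' s'w' in lower h w sw (from (Bisim⇒Bisim₀ k M w M' w' b p x) v)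
  ⫤-bisim (¬' φ) = ⊨-bisim φ
  ⫤-bisim (φ ∧' ψ) k d≤k M M' = Split-preserved k M M'
    (⫤-bisim φ k (m⊔n≤o⇒m≤o (modalDepth φ) _ d≤k) M M')
    (⫤-bisim ψ k (m⊔n≤o⇒n≤o (modalDepth φ) _ d≤k) M M')
  ⫤-bisim (φ ∨' ψ) k d≤k M M' s s' B (φs , ψs) =
    ⫤-bisim φ k (m⊔n≤o⇒m≤o (modalDepth φ) _ d≤k) M M' s s' B φs ,
    ⫤-bisim ψ k (m⊔n≤o⇒n≤o (modalDepth φ) _ d≤k) M M' s s' B ψs
  ⫤-bisim (◇ φ) (suc k) (s≤s d≤k) M M' s s' (_ , back) h w' s'w' =
    let (w , sw , (_ , forth , back′)) = back w' s'w'
    in ⫤-bisim φ k d≤k M M' (Succ M w) (Succ M' w') (forth , back′) (h w sw)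
  ⫤-bisim NE k _ M M' s s' (_ , back) (lift s=∅) =
    lift λ w' s'w' → let (w , sw , _) = back w' s'w' in s=∅ w sw

Convex : (X : PropSet) → StateProperty X → Set₁
Convex X P = (M : Model X) → ConvexIn M (P M)

InBSML⇒InU : ∀ {X} (P : StateProperty X) → InBSML X P → InU X P
InBSML⇒InU P (φ , P⇔φ) =
  (modalDepth φ , λ M s M' s' Ps B →
     from (P⇔φ M' s') (⊨-bisim φ _ ≤-refl M M' s s' B (to (P⇔φ M s) Ps))) ,
  λ M I S i₀ PS →
     from (P⇔φ M (⋃ {M = M} S)) (⊨-unionClosed φ M I S i₀ (λ i → to (P⇔φ M (S i)) (PS i)))

InBSML⇒Convex : ∀ {X} (P : StateProperty X) → InBSML X P → Convex X P
InBSML⇒Convex P (φ , P⇔φ) M s t u s⊆t t⊆u Ps Pu =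
  from (P⇔φ M t) (⊨-convex φ M s t u s⊆t t⊆u (to (P⇔φ M s) Ps) (to (P⇔φ M u) Pu))

-- Stated as an implication from non-emptiness, so that union closure is constructive.
NotOnlyDeadEnds : (X : PropSet) → StateProperty X
NotOnlyDeadEnds X M s =
  Lift (lsuc 0ℓ) (NonEmpty {M = M} s → Σ (W M) λ w → s w × NonEmpty {M = M} (Succ M w))

NotOnlyDeadEnds-InU : (X : PropSet) → InU X (NotOnlyDeadEnds X)
NotOnlyDeadEnds-InU X = (1 , invariant) , unionClosed
  where
  invariant : (M : Model X) (s : State M) (M' : Model X) (s' : State M') →
    NotOnlyDeadEnds X M s → BisimState 1 M s M' s' → NotOnlyDeadEnds X M' s'
  invariant M s M' s' (lift live) (forth , back) = lift λ (w' , s'w') →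
    let (w , sw , _) = back w' s'w'
        (v , sv , x , vRx) = live (w , sw)
        (v' , s'v' , (_ , forthᵥ , _)) = forth v sv
        (x' , v'Rx' , _) = forthᵥ x vRx
    in v' , s'v' , x' , v'Rx'
  unionClosed : UnionClosed X (NotOnlyDeadEnds X)
  unionClosed M I S i₀ h = lift λ (w , i , sw) →
    let (v , sv , rest) = lower (h i) (w , sw) in v , (i , sv) , rest

arrow : (X : PropSet) → Model X
arrow X = record
  { W = Bool ; R = λ w v → (w ≡ true) × (v ≡ false) ; V = λ _ _ _ → ⊥ ; inhabited = true }

NotOnlyDeadEnds-nonConvex : (X : PropSet) → ¬ Convex X (NotOnlyDeadEnds X)
NotOnlyDeadEnds-nonConvex X convex with
  lower (convex (arrow X) (λ _ → ⊥) (_≡ false) (λ _ → ⊤) (λ _ ()) (λ _ _ → tt)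
           (lift λ ()) (lift λ _ → true , tt , false , refl , refl))
        (false , refl)
... | (.false , refl , _ , () , _)

fact3p19 : (X : PropSet) →
    ((P : StateProperty X) → InBSML X P → InU X P) ×
    (Σ (StateProperty X) λ P → InU X P × ¬ InBSML X P)
fact3p19 X =
  InBSML⇒InU ,
  NotOnlyDeadEnds X , NotOnlyDeadEnds-InU X ,
  λ inBSML → NotOnlyDeadEnds-nonConvex X (InBSML⇒Convex (NotOnlyDeadEnds X) inBSML)
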